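{- Let $G=(V,E)$ be a simple undirected graph with $V=\{1,\dots,n\}$, let $l\ge 1$ be an integer and let $u,v\in V$. Let $|\psi_G\rangle\in\mathcal{H}_{V^2}$ be the basis state with $x_{\{w,z\}}=1$ if $\{w,z\}\in E$ and $x_{\{w,z\}}=0$ otherwise. Let $\mathbf{N}$ be the $n\times n$ matrix of operators with $\mathbf{N}_{w,z}=N_{\{w,z\}}$ for $w\neq z$ and $\mathbf{N}_{w,w}=0$, and let $\mathbf{N}^l$ be its $l$-th power under ordinary matrix multiplication (so $(\mathbf{N}^l)_{u,v}=\sum_{w_2,\dots,w_l}\mathbf{N}_{u,w_2}\mathbf{N}_{w_2,w_3}\cdots\mathbf{N}_{w_l,v}$). Then the number $t(G,l;u,v)$ of trails of length $l$ in $G$ with initial vertex $u$ and final vertex $v$ equals \[ t(G,l;u,v)=\langle\psi_G|\,\colon(\mathbf{N}^l)_{u,v}\colon\,|\psi_G\rangle. \]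
   Context: A walk of length $l$ in $G$ is a sequence of vertices $v_1v_2\cdots v_{l+1}$ with $\{v_i,v_{i+1}\}\in E$ for every $1\le i\le l$; its initial vertex is $v_1$ and final vertex is $v_{l+1}$ (walks with $v_1=v_{l+1}$ are allowed). A trail is a walk in which no edge $\{v_i,v_{i+1}\}$ is repeated. Let $\mathcal{H}_2=\mathrm{span}\{|0\rangle,|1\rangle\}$ with operators $a,a^\dagger$ given by $a|0\rangle=0$, $a|1\rangle=|0\rangle$, $a^\dagger|0\rangle=|1\rangle$, $a^\dagger|1\rangle=0$, and number operator $N=a^\dagger a$. Let $\mathcal{H}_{V^2}=\bigotimes_{\{w,z\}}(\mathcal{H}_2)_{\{w,z\}}$, one qubit for each unordered pair of distinct vertices (dimension $2^{\binom n2}$), with computational basis $|x\rangle=\bigotimes|x_{\{w,z\}}\rangle$, $x_{\{w,z\}}\in\{0,1\}$. For each pair, $a_{\{w,z\}},a^\dagger_{\{w,z\}},N_{\{w,z\}}=a^\dagger_{\{w,z\}}a_{\{w,z\}}$ denote the corresponding operators acting on the factor $(\mathcal{H}_2)_{\{w,z\}}$ (identity elsewhere); operators on different factors commute, and $N_{\{w,z\}}|x\rangle=x_{\{w,z\}}|x\rangle$. Normal ordering $\colon\cdot\colon$ is defined on each monomial in these operators by moving all creation operators $a^\dagger$ to the left of all annihilation operators $a$ (so e.g. $\colon N^2\colon=a^\dagger a^\dagger a a$), and is extended linearly to sums of monomials; it is applied to the entry $(\mathbf{N}^l)_{u,v}$ written as a sum of products of number operators. -}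

module Defs where

open import Data.Nat using (ℕ; zero; suc)
open import Data.Bool using (Bool; true; false; if_then_else_; _∧_; not)
open import Data.Fin using (Fin; _<_)
open import Data.Fin.Properties using (<-cmp; _≟_)
open import Data.Product using (Σ; _×_; _,_; proj₁; proj₂)
open import Data.Maybe using (Maybe; just; nothing; maybe; _>>=_)
open import Data.List using (List; []; _∷_; _++_; map; concatMap; allFin; filter; catMaybes; foldr)
open import Data.Bool.ListAction using (all; any)
open import Data.Vec using (Vec; head; last; toList)
open import Relation.Nullary using (does)
open import Relation.Binary using (tri<; tri≈; tri>)
open import Relation.Binary.PropositionalEquality using (_≡_)

-- Unordered pairs {w,z} of distinct vertices of V = Fin n,
-- represented canonically as (w , z) with w < z.

Pair : ℕ → Set
Pair n = Σ (Fin n × Fin n) (λ p → proj₁ p < proj₂ p)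

pairOf : ∀ {n} → Fin n → Fin n → Maybe (Pair n)
pairOf w z with <-cmp w z
... | tri< w<z _ _ = just ((w , z) , w<z)
... | tri≈ _ _ _   = nothing
... | tri> _ _ z<w = just ((z , w) , z<w)

_==P_ : ∀ {n} → Pair n → Pair n → Bool
((a , b) , _) ==P ((c , d) , _) = does (a ≟ c) ∧ does (b ≟ d)

allPairs : ∀ n → List (Pair n)
allPairs n = catMaybes (concatMap (λ w → map (λ z → pairOfLt w z) (allFin n)) (allFin n))
  where
  pairOfLt : Fin n → Fin n → Maybe (Pair n)
  pairOfLt w z with <-cmp w z
  ... | tri< w<z _ _ = just ((w , z) , w<z)
  ... | tri≈ _ _ _   = nothing
  ... | tri> _ _ _   = nothing

-- Simple undirected graphs on V = Fin n: the edge set as a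
-- characteristic function on unordered pairs of distinct vertices.

Graph : ℕ → Set
Graph n = Pair n → Bool

adj : ∀ {n} → Graph n → Fin n → Fin n → Bool
adj G w z = maybe G false (pairOf w z)

steps : ∀ {n} → List (Fin n) → List (Maybe (Pair n))
steps (w ∷ rest@(z ∷ _)) = pairOf w z ∷ steps rest
steps _ = []

distinct : ∀ {n} → List (Pair n) → Bool
distinct [] = true
distinct (p ∷ ps) = not (any (p ==P_) ps) ∧ distinct ps

isTrail : ∀ {n} → Graph n → List (Fin n) → Bool
isTrail G vs = all (maybe G false) (steps vs) ∧ distinct (catMaybes (steps vs))

Trail : ∀ {n} → Graph n → ℕ → Fin n → Fin n → Set
Trail {n} G l u v =
  Σ (Vec (Fin n) (suc l)) λ vs →
    (head vs ≡ u) × (last vs ≡ v) × (isTrail G (toList vs) ≡ true)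

-- The qubit space H_{V^2}: one qubit per unordered pair.
-- Computational basis states |x⟩, x : Pair n → Bool.

State : ℕ → Set
State n = Pair n → Bool

psi : ∀ {n} → Graph n → State n
psi G = G

data Letter (n : ℕ) : Set where
  cre : Pair n → Letter n
  ann : Pair n → Letter n

-- monomials (operator products, written left to right) and
-- sums of monomials (all coefficients 1)
Word : ℕ → Set
Word n = List (Letter n)

Op : ℕ → Set
Op n = List (Word n)

update : ∀ {n} → State n → Pair n → Bool → State n
update x p b q = if p ==P q then b else x q

-- action of a letter on a basis state: another basis state or 0 (nothing)
-- a†|0⟩=|1⟩, a†|1⟩=0, a|1⟩=|0⟩, a|0⟩=0
applyLetter : ∀ {n} → Letter n → State n → Maybe (State n)
applyLetter (cre p) x = if x p then nothing else just (update x p true)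
applyLetter (ann p) x = if x p then just (update x p false) else nothing

-- action of a monomial: the rightmost letter acts first
applyWord : ∀ {n} → Word n → State n → Maybe (State n)
applyWord [] x = just x
applyWord (c ∷ w) x = applyWord w x >>= applyLetter c

eqState : ∀ {n} → State n → State n → Bool
eqState {n} x y = all (λ p → does (Data.Bool._≟_ (x p) (y p))) (allPairs n)
  where import Data.Bool

amp : ∀ {n} → State n → Word n → State n → ℕ
amp y w x = maybe (λ z → if eqState y z then 1 else 0) 0 (applyWord w x)

expect : ∀ {n} → State n → Op n → ℕ
expect x A = foldr (λ w acc → amp x w x Data.Nat.+ acc) 0 A
  where import Data.Nat

isCre : ∀ {n} → Letter n → Bool
isCre (cre _) = true
isCre (ann _) = false

normalWord : ∀ {n} → Word n → Word n
normalWord w = filterB isCre w ++ filterB (λ c → not (isCre c)) w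
  where
  filterB : ∀ {n} → (Letter n → Bool) → Word n → Word n
  filterB f [] = []
  filterB f (c ∷ cs) = if f c then c ∷ filterB f cs else filterB f cs

normal : ∀ {n} → Op n → Op n
normal = map normalWord

Mat : ℕ → Set
Mat n = Fin n → Fin n → Op n

_·_ : ∀ {n} → Op n → Op n → Op n
A · B = concatMap (λ a → map (a ++_) B) A

_⊗_ : ∀ {n} → Mat n → Mat n → Mat n
_⊗_ {n} A B u v = concatMap (λ w → A u w · B w v) (allFin n)

-- identity matrix (the empty word is the identity operator)
idMat : ∀ {n} → Mat n
idMat u v = if does (u ≟ v) then [] ∷ [] else []

Nmat : ∀ {n} → Mat n
Nmat w z = maybe (λ p → (cre p ∷ ann p ∷ []) ∷ []) [] (pairOf w z)

Npow : ∀ {n} → ℕ → Mat n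
Npow zero = idMat
Npow (suc l) = Nmat ⊗ Npow l

module Submission where

-- Expanding the matrix power, (𝐍^l)_{u,v} is a sum of
-- monomials N_{p₁} N_{p₂} ⋯ N_{p_l}, one for every vertex sequence
-- u = w₁, w₂, …, w_{l+1} = v with consecutive vertices distinct, where
-- p_i = {w_i, w_{i+1}}.  Normal ordering turns such a monomial into
-- a†_{p₁} ⋯ a†_{p_l} a_{p₁} ⋯ a_{p_l}.  On a basis state |x⟩ the
-- annihilators succeed exactly when every p_i is occupied and the p_i are
-- pairwise distinct, and the creators then restore |x⟩; so the diagonal
-- matrix element is 1 precisely when p₁, …, p_l are distinct edges of G.
-- Summing over vertex sequences, the expectation counts the trails.

open import Defs
open import Data.Nat using (ℕ; zero; suc; _+_; _≤_)
open import Data.Nat.ListAction using (sum)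
open import Data.Nat.ListAction.Properties using (sum-++)
import Data.Nat.Properties as ℕ
open import Data.Bool using (Bool; true; false; not; _∧_; if_then_else_)
open import Data.Bool.ListAction using (and; all; any)
open import Data.Bool.Properties
  using (∧-conicalˡ; ∧-conicalʳ; ∧-zeroʳ; ∧-identityʳ; ∧-comm; ∨-zeroʳ; not-injective;
         ∧-commutativeMonoid; if-float; if-∧)
  renaming (_≟_ to _≟ᵇ_)
open import Data.Fin using (Fin; zero; suc)
open import Data.Fin.Properties using (_≟_; <-irrelevant; +↔⊎)
open import Data.List using (List; []; _∷_; _++_; map; concatMap; catMaybes; allFin; tabulate)
open import Data.List.Properties using (∷-injective; map-++; map-∘; map-cong; map-tabulate; ++-assoc; ++-identityʳ)
open import Data.List.Relation.Unary.All using (All; []; _∷_)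
open import Data.Maybe using (Maybe; just; nothing; maybe; _>>=_)
open import Data.Vec using (Vec; []; _∷_; last; toList)
open import Data.Product using (Σ; _×_; _,_; proj₁; proj₂)
open import Data.Product.Function.Dependent.Propositional using (Σ-↔)
open import Data.Empty using (⊥; ⊥-elim)
open import Data.Sum using (_⊎_; inj₁; inj₂)
open import Data.Sum.Function.Propositional using (_⊎-cong_)
open import Function.Base using (_∘_)
open import Function.Bundles using (_↔_; mk↔ₛ′)
open import Function.Properties.Inverse using (↔-refl; ↔-trans)
open import Relation.Nullary using (Dec; does; yes; no)
open import Relation.Nullary.Decidable using (dec-true)
open import Relation.Binary.PropositionalEquality
open import Algebra.Bundles using (CommutativeMonoid)
open import Algebra.Properties.CommutativeSemigroup
  (CommutativeMonoid.commutativeSemigroup ∧-commutativeMonoid) using (interchange)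
open import Axiom.UniquenessOfIdentityProofs using (module Decidable⇒UIP)

-- equality proofs between booleans, resp. vertices, are unique; the
-- bijections below compare witnesses of 'P ws ≡ true' and 'last vs ≡ v'
Bool-UIP : {a b : Bool} (p q : a ≡ b) → p ≡ q
Bool-UIP = Decidable⇒UIP.≡-irrelevant _≟ᵇ_

Fin-UIP : ∀ {n} {a b : Fin n} (p q : a ≡ b) → p ≡ q
Fin-UIP = Decidable⇒UIP.≡-irrelevant _≟_

does-sound : ∀ {A : Set} (d : Dec A) → does d ≡ true → A
does-sound (yes a) _ = a

module _ {n : ℕ} where

  ==P-refl : (p : Pair n) → p ==P p ≡ true
  ==P-refl ((a , b) , _) = cong₂ _∧_ (dec-true (a ≟ a) refl) (dec-true (b ≟ b) refl)

  ==P-sound : (p q : Pair n) → p ==P q ≡ true → p ≡ q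
  ==P-sound ((a , b) , a<b) ((c , d) , c<d) eq with a ≟ c | b ≟ d | eq
  ... | yes refl | yes refl | _ = cong ((a , b) ,_) (<-irrelevant a<b c<d)
  ... | no _     | _        | ()
  ... | yes _    | no _     | ()

  ==P-sym : (p q : Pair n) → p ==P q ≡ q ==P p
  ==P-sym p q with p ==P q in pq | q ==P p in qp
  ... | true  | true  = refl
  ... | false | false = refl
  ... | true  | false with ==P-sound p q pq
  ...   | refl = trans (sym (==P-refl p)) qp
  ==P-sym p q | false | true with ==P-sound q p qp
  ...   | refl = trans (sym pq) (==P-refl p)

  -- membership test matching the one used by 'distinct':
  -- distinct (p ∷ ps) is definitionally  not (p ∈? ps) ∧ distinct ps
  _∈?_ : Pair n → List (Pair n) → Bool
  p ∈? ps = any (p ==P_) ps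

  ∈?-head : (p : Pair n) (ps : List (Pair n)) → p ∈? (p ∷ ps) ≡ true
  ∈?-head p ps rewrite ==P-refl p = refl

  ∈?-tail : (p q : Pair n) (ps : List (Pair n)) → q ∈? ps ≡ true → q ∈? (p ∷ ps) ≡ true
  ∈?-tail p q ps q∈ps rewrite q∈ps = ∨-zeroʳ (q ==P p)

  all-∈? : (x : State n) (ps : List (Pair n)) (q : Pair n) →
           all x ps ≡ true → q ∈? ps ≡ true → x q ≡ true
  all-∈? x (p ∷ ps) q allx q∈ with q ==P p in qp
  ... | true  rewrite ==P-sound q p qp = ∧-conicalˡ (x p) _ allx
  ... | false = all-∈? x ps q (∧-conicalʳ (x p) _ allx) q∈

  assign : State n → List (Pair n) → Bool → State n
  assign x []       b = x
  assign x (p ∷ ps) b = update (assign x ps b) p b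

  assign-at : (x : State n) (ps : List (Pair n)) (b : Bool) (q : Pair n) →
              assign x ps b q ≡ (if q ∈? ps then b else x q)
  assign-at x []       b q = refl
  assign-at x (p ∷ ps) b q rewrite ==P-sym p q with q ==P p
  ... | true  = refl
  ... | false = assign-at x ps b q

  assign-members : (x : State n) (ps : List (Pair n)) (b : Bool) →
                   ∀ q → q ∈? ps ≡ true → assign x ps b q ≡ b
  assign-members x ps b q q∈ rewrite assign-at x ps b q | q∈ = refl

module _ {n : ℕ} where

  creations annihilations : Word n → Word n
  creations []          = []
  creations (cre p ∷ w) = cre p ∷ creations w
  creations (ann p ∷ w) = creations w
  annihilations []          = []
  annihilations (cre p ∷ w) = annihilations w
  annihilations (ann p ∷ w) = ann p ∷ annihilations w

  data Creation : Letter n → Set where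
    cre : (p : Pair n) → Creation (cre p)

  creations-only : (w : Word n) → All Creation (creations w)
  creations-only []          = []
  creations-only (cre p ∷ w) = cre p ∷ creations-only w
  creations-only (ann p ∷ w) = creations-only w

  commute-twice : (A : Word n) (c : Letter n) (B : Word n) →
                  A ++ c ∷ B ≡ c ∷ A ++ B → A ++ c ∷ c ∷ B ≡ c ∷ c ∷ A ++ B
  commute-twice []      c B eq = refl
  commute-twice (a ∷ A) c B eq with ∷-injective eq
  ... | refl , eq′ = cong (c ∷_) (commute-twice A c B eq′)

  -- The split point of A ++ B is pinned down by inserting single
  -- annihilators there, well enough to insert two of them.  This is how
  -- the (otherwise inaccessible) halves of normalWord are identified.
  insert-at-cut : (A B A′ B′ : Word n) (q p : Pair n) → All Creation A′ →
    A ++ B ≡ A′ ++ B′ →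
    A ++ ann q ∷ B ≡ A′ ++ ann q ∷ B′ →
    A ++ ann p ∷ B ≡ A′ ++ ann p ∷ B′ →
    A ++ ann q ∷ ann p ∷ B ≡ A′ ++ ann q ∷ ann p ∷ B′
  insert-at-cut []      B []       B′ q p _            refl _  _  = refl
  insert-at-cut []      B (_ ∷ _)  B′ q p (cre r ∷ _) _    () _
  insert-at-cut (a ∷ A) B []       .(a ∷ A ++ B) q p _ refl eq ep
    with ∷-injective eq | ∷-injective ep
  ... | refl , eq′ | refl , _ = cong (ann q ∷_) (commute-twice A (ann q) B eq′)
  insert-at-cut (a ∷ A) B (_ ∷ A′) B′ q p (cre r ∷ cs) e0 eq ep
    with ∷-injective e0 | ∷-injective eq | ∷-injective ep
  ... | refl , e0′ | _ , eq′ | _ , ep′ = cong (a ∷_) (insert-at-cut A B A′ B′ q p cs e0′ eq′ ep′)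

  -- normalWord w = creations w ++ annihilations w; the second component
  -- (one annihilator inserted at the cut) is what makes the induction go
  -- through, since normalWord is only observable through its values
  normal-split : (w : Word n) →
    normalWord w ≡ creations w ++ annihilations w ×
    (∀ q → normalWord (ann q ∷ w) ≡ creations w ++ ann q ∷ annihilations w)
  normal-split [] = refl , λ q → refl
  normal-split (cre p ∷ w) =
    cong (cre p ∷_) (proj₁ (normal-split w)) , λ q → cong (cre p ∷_) (proj₂ (normal-split w) q)
  normal-split (ann p ∷ w) = at p , λ q →
    insert-at-cut _ _ (creations w) (annihilations w) q p (creations-only w) whole (at q) (at p)
    where
    whole : normalWord w ≡ creations w ++ annihilations w
    whole = proj₁ (normal-split w)
    at : ∀ q → normalWord (ann q ∷ w) ≡ creations w ++ ann q ∷ annihilations w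
    at = proj₂ (normal-split w)

module _ {n : ℕ} where

  applyWord-++ : (X Y : Word n) (x : State n) →
                 applyWord (X ++ Y) x ≡ (applyWord Y x >>= applyWord X)
  applyWord-++ []      Y x with applyWord Y x
  ... | just _  = refl
  ... | nothing = refl
  applyWord-++ (c ∷ X) Y x rewrite applyWord-++ X Y x with applyWord Y x
  ... | just _  = refl
  ... | nothing = refl

  annihilate-one : (x : State n) (ps : List (Pair n)) (p : Pair n) →
    applyLetter (ann p) (assign x ps false)
      ≡ (if x p ∧ not (p ∈? ps) then just (assign x (p ∷ ps) false) else nothing)
  annihilate-one x ps p rewrite assign-at x ps false p with p ∈? ps
  ... | true  rewrite ∧-zeroʳ (x p)     = refl
  ... | false rewrite ∧-identityʳ (x p) = refl

  annihilate : (x : State n) (ps : List (Pair n)) →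
    applyWord (map ann ps) x ≡ (if all x ps ∧ distinct ps then just (assign x ps false) else nothing)
  annihilate x []       = refl
  annihilate x (p ∷ ps) = begin
    (applyWord (map ann ps) x >>= applyLetter (ann p))
      ≡⟨ cong (_>>= applyLetter (ann p)) (annihilate x ps) ⟩
    ((if all x ps ∧ distinct ps then just (assign x ps false) else nothing) >>= applyLetter (ann p))
      ≡⟨ if-float (_>>= applyLetter (ann p)) (all x ps ∧ distinct ps) ⟩
    (if all x ps ∧ distinct ps then applyLetter (ann p) (assign x ps false) else nothing)
      ≡⟨ cong (if all x ps ∧ distinct ps then_else nothing) (annihilate-one x ps p) ⟩
    (if all x ps ∧ distinct ps then (if x p ∧ not (p ∈? ps) then cleared else nothing) else nothing)
      ≡⟨ if-∧ (all x ps ∧ distinct ps) ⟨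
    (if (all x ps ∧ distinct ps) ∧ (x p ∧ not (p ∈? ps)) then cleared else nothing)
      ≡⟨ cong (if_then cleared else nothing) (regroup (all x ps) (distinct ps) (x p) (not (p ∈? ps))) ⟩
    (if all x (p ∷ ps) ∧ distinct (p ∷ ps) then cleared else nothing) ∎
    where
    open ≡-Reasoning
    cleared : Maybe (State n)
    cleared = just (assign x (p ∷ ps) false)
    regroup : ∀ a d b c → (a ∧ d) ∧ (b ∧ c) ≡ (b ∧ a) ∧ (c ∧ d)
    regroup a d b c = trans (∧-comm (a ∧ d) (b ∧ c)) (interchange b c a d)

  create : (x : State n) (ps : List (Pair n)) →
    (∀ q → q ∈? ps ≡ true → x q ≡ false) → distinct ps ≡ true →
    applyWord (map cre ps) x ≡ just (assign x ps true)
  create x []       empty dist = refl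
  create x (p ∷ ps) empty dist
    rewrite create x ps (λ q q∈ → empty q (∈?-tail p q ps q∈)) (∧-conicalʳ _ _ dist)
          | assign-at x ps true p
          | not-injective {p ∈? ps} {false} (∧-conicalˡ _ _ dist)
          | empty p (∈?-head p ps) = refl

  refill : (x : State n) (ps : List (Pair n)) → all x ps ≡ true →
           ∀ q → x q ≡ assign (assign x ps false) ps true q
  refill x ps allx q rewrite assign-at (assign x ps false) ps true q | assign-at x ps false q
    with q ∈? ps in q∈
  ... | true  = all-∈? x ps q allx q∈
  ... | false = refl

  eqState-pointwise : (x y : State n) → (∀ q → x q ≡ y q) → eqState x y ≡ true
  eqState-pointwise x y x≗y = all-true (allPairs n) λ q → dec-true (x q ≟ᵇ y q) (x≗y q)
    where
    all-true : ∀ {A : Set} {f : A → Bool} xs → (∀ a → f a ≡ true) → all f xs ≡ true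
    all-true []       _ = refl
    all-true (a ∷ as) h rewrite h a = all-true as h

  amplitude : (x : State n) (ps : List (Pair n)) →
    amp x (map cre ps ++ map ann ps) x ≡ (if all x ps ∧ distinct ps then 1 else 0)
  amplitude x ps rewrite applyWord-++ (map cre ps) (map ann ps) x | annihilate x ps
    with all x ps ∧ distinct ps in ok
  ... | false = refl
  ... | true  rewrite create (assign x ps false) ps (assign-members x ps false) (∧-conicalʳ _ _ ok)
                    | eqState-pointwise x _ (refill x ps (∧-conicalˡ _ _ ok)) = refl

module _ {n : ℕ} where

  numberWord : List (Pair n) → Word n
  numberWord []       = []
  numberWord (p ∷ ps) = cre p ∷ ann p ∷ numberWord ps

  numberWord-++ : (ps qs : List (Pair n)) → numberWord (ps ++ qs) ≡ numberWord ps ++ numberWord qs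
  numberWord-++ []       qs = refl
  numberWord-++ (p ∷ ps) qs = cong (λ w → cre p ∷ ann p ∷ w) (numberWord-++ ps qs)

  normal-numberWord : (ps : List (Pair n)) → normalWord (numberWord ps) ≡ map cre ps ++ map ann ps
  normal-numberWord ps = begin
    normalWord (numberWord ps)                               ≡⟨ proj₁ (normal-split (numberWord ps)) ⟩
    creations (numberWord ps) ++ annihilations (numberWord ps) ≡⟨ cong₂ _++_ (creations-number ps) (annihilations-number ps) ⟩
    map cre ps ++ map ann ps                                 ∎
    where
    open ≡-Reasoning
    creations-number : ∀ ps → creations (numberWord ps) ≡ map cre ps
    creations-number []       = refl
    creations-number (p ∷ ps) = cong (cre p ∷_) (creations-number ps)
    annihilations-number : ∀ ps → annihilations (numberWord ps) ≡ map ann ps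
    annihilations-number []       = refl
    annihilations-number (p ∷ ps) = cong (ann p ∷_) (annihilations-number ps)

  normal-number-amplitude : (x : State n) (ps : List (Pair n)) →
    amp x (normalWord (numberWord ps)) x ≡ (if all x ps ∧ distinct ps then 1 else 0)
  normal-number-amplitude x ps rewrite normal-numberWord ps = amplitude x ps

expect-normal : ∀ {n} (x : State n) (A : Op n) →
                expect x (normal A) ≡ sum (map (λ w → amp x (normalWord w) x) A)
expect-normal x []      = refl
expect-normal x (w ∷ A) = cong (amp x (normalWord w) x +_) (expect-normal x A)

sum-concatMap : ∀ {A B : Set} (f : B → ℕ) (F : A → List B) (xs : List A) →
                sum (map f (concatMap F xs)) ≡ sum (map (λ a → sum (map f (F a))) xs)
sum-concatMap f F []       = refl
sum-concatMap f F (a ∷ as) = begin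
  sum (map f (F a ++ concatMap F as))              ≡⟨ cong sum (map-++ f (F a) (concatMap F as)) ⟩
  sum (map f (F a) ++ map f (concatMap F as))      ≡⟨ sum-++ (map f (F a)) _ ⟩
  sum (map f (F a)) + sum (map f (concatMap F as)) ≡⟨ cong (sum (map f (F a)) +_) (sum-concatMap f F as) ⟩
  sum (map (λ a → sum (map f (F a))) (a ∷ as))     ∎
  where open ≡-Reasoning

sum-zero : ∀ {A : Set} (f : A → ℕ) (xs : List A) → (∀ a → f a ≡ 0) → sum (map f xs) ≡ 0
sum-zero f []       _   = refl
sum-zero f (a ∷ as) f≗0 rewrite f≗0 a = sum-zero f as f≗0

Fin-sum-↔ : ∀ m (g : Fin m → ℕ) → Fin (sum (map g (allFin m))) ↔ Σ (Fin m) (λ i → Fin (g i))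
Fin-sum-↔ m g rewrite map-tabulate (λ i → i) g = tabulated m g
  where
  Σ-Fin-suc : ∀ {m} (F : Fin (suc m) → Set) → (F zero ⊎ Σ (Fin m) (λ i → F (suc i))) ↔ Σ (Fin (suc m)) F
  Σ-Fin-suc F = mk↔ₛ′
    (λ { (inj₁ y) → zero , y ; (inj₂ (i , y)) → suc i , y })
    (λ { (zero , y) → inj₁ y ; (suc i , y) → inj₂ (i , y) })
    (λ { (zero , y) → refl ; (suc i , y) → refl })
    (λ { (inj₁ y) → refl ; (inj₂ (i , y)) → refl })
  tabulated : ∀ m (g : Fin m → ℕ) → Fin (sum (tabulate g)) ↔ Σ (Fin m) (λ i → Fin (g i))
  tabulated zero    g = mk↔ₛ′ (λ ()) (λ ()) (λ ()) (λ ())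
  tabulated (suc m) g =
    ↔-trans +↔⊎ (↔-trans (↔-refl ⊎-cong tabulated m (λ i → g (suc i))) (Σ-Fin-suc (λ i → Fin (g i))))

module _ {n : ℕ} where

  count : ∀ k → (Vec (Fin n) k → Bool) → ℕ
  count zero    P = if P [] then 1 else 0
  count (suc k) P = sum (map (λ w → count k (λ ws → P (w ∷ ws))) (allFin n))

  count-cong : ∀ k {P Q : Vec (Fin n) k → Bool} → (∀ ws → P ws ≡ Q ws) → count k P ≡ count k Q
  count-cong zero    P≗Q rewrite P≗Q [] = refl
  count-cong (suc k) P≗Q = cong sum (map-cong (λ w → count-cong k (λ ws → P≗Q (w ∷ ws))) (allFin n))

  count-none : ∀ k (P : Vec (Fin n) k → Bool) → (∀ ws → P ws ≡ false) → count k P ≡ 0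
  count-none zero    P none rewrite none [] = refl
  count-none (suc k) P none = sum-zero _ (allFin n) (λ w → count-none k _ (λ ws → none (w ∷ ws)))

  count-↔ : ∀ k (P : Vec (Fin n) k → Bool) → Fin (count k P) ↔ Σ (Vec (Fin n) k) (λ ws → P ws ≡ true)
  count-↔ zero P with P [] in P[]
  ... | true  = mk↔ₛ′ (λ _ → [] , P[]) (λ _ → zero)
                  (λ { ([] , P[]′) → cong ([] ,_) (Bool-UIP P[] P[]′) }) (λ { zero → refl })
  ... | false = mk↔ₛ′ (λ ()) (λ { ([] , P[]′) → ⊥-elim (not-true P[]′) })
                  (λ { ([] , P[]′) → ⊥-elim (not-true P[]′) }) (λ ())
    where
    not-true : P [] ≡ true → ⊥
    not-true P[]′ with () ← trans (sym P[]) P[]′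
  count-↔ (suc k) P =
    ↔-trans (Fin-sum-↔ n (λ w → count k (λ ws → P (w ∷ ws))))
      (↔-trans (Σ-↔ ↔-refl (count-↔ k (λ ws → P (_ ∷ ws)))) uncons-↔)
    where
    uncons-↔ : Σ (Fin n) (λ w → Σ (Vec (Fin n) k) (λ ws → P (w ∷ ws) ≡ true))
             ↔ Σ (Vec (Fin n) (suc k)) (λ ws → P ws ≡ true)
    uncons-↔ = mk↔ₛ′ (λ { (w , ws , ok) → w ∷ ws , ok }) (λ { (w ∷ ws , ok) → w , ws , ok })
                     (λ { (w ∷ ws , ok) → refl }) (λ { (w , ws , ok) → refl })

module _ {n : ℕ} (G : Graph n) where

  -- every step is an edge of G and no edge is used twice;
  -- isTrail G vs is by definition  edgesOk (steps vs)
  edgesOk : List (Maybe (Pair n)) → Bool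
  edgesOk ms = all (maybe G false) ms ∧ distinct (catMaybes ms)

  edgesOk-just : (ps : List (Pair n)) → edgesOk (map just ps) ≡ all G ps ∧ distinct ps
  edgesOk-just ps = cong₂ _∧_ (cong and (sym (map-∘ ps))) (cong distinct (catMaybes-just ps))
    where
    catMaybes-just : ∀ (ps : List (Pair n)) → catMaybes (map just ps) ≡ ps
    catMaybes-just []       = refl
    catMaybes-just (p ∷ ps) = cong (p ∷_) (catMaybes-just ps)

  edgesOk-nothing : (ms rs : List (Maybe (Pair n))) → edgesOk (ms ++ nothing ∷ rs) ≡ false
  edgesOk-nothing ms rs = cong (_∧ distinct (catMaybes (ms ++ nothing ∷ rs))) (no-edge ms)
    where
    no-edge : ∀ ms → all (maybe G false) (ms ++ nothing ∷ rs) ≡ false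
    no-edge []       = refl
    no-edge (m ∷ ms) rewrite no-edge ms = ∧-zeroʳ (maybe G false m)

  continues : ∀ l → List (Pair n) → Fin n → Fin n → Vec (Fin n) l → Bool
  continues l ps u v ws = does (last (u ∷ ws) ≟ v) ∧ edgesOk (map just ps ++ steps (u ∷ toList ws))

  weight : List (Pair n) → Word n → ℕ
  weight ps w = amp G (normalWord (numberWord ps ++ w)) G

  weight-snoc : (ps : List (Pair n)) (p : Pair n) (w : Word n) →
                weight ps ((cre p ∷ ann p ∷ []) ++ w) ≡ weight (ps ++ p ∷ []) w
  weight-snoc ps p w = cong (λ u → amp G (normalWord u) G) (begin
    numberWord ps ++ (cre p ∷ ann p ∷ []) ++ w    ≡⟨ ++-assoc (numberWord ps) _ w ⟨
    (numberWord ps ++ numberWord (p ∷ [])) ++ w  ≡⟨ cong (_++ w) (numberWord-++ ps (p ∷ [])) ⟨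
    numberWord (ps ++ p ∷ []) ++ w               ∎)
    where open ≡-Reasoning

  absorb-factor : (ps : List (Pair n)) (p : Pair n) (B : Op n) →
    sum (map (weight ps) (((cre p ∷ ann p ∷ []) ∷ []) · B)) ≡ sum (map (weight (ps ++ p ∷ [])) B)
  absorb-factor ps p B = begin
    sum (map (weight ps) (map (Np ++_) B ++ []))   ≡⟨ cong (sum ∘ map (weight ps)) (++-identityʳ (map (Np ++_) B)) ⟩
    sum (map (weight ps) (map (Np ++_) B))         ≡⟨ cong sum (map-∘ B) ⟨
    sum (map (weight ps ∘ (Np ++_)) B)             ≡⟨ cong sum (map-cong (weight-snoc ps p) B) ⟩
    sum (map (weight (ps ++ p ∷ [])) B)            ∎
    where
    open ≡-Reasoning
    Np : Word n
    Np = cre p ∷ ann p ∷ []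

  edgesOk-snoc : (ps : List (Pair n)) (p : Pair n) (ms : List (Maybe (Pair n))) →
                 edgesOk (map just (ps ++ p ∷ []) ++ ms) ≡ edgesOk (map just ps ++ just p ∷ ms)
  edgesOk-snoc ps p ms = cong edgesOk (trans (cong (_++ ms) (map-++ just ps (p ∷ [])))
                                             (++-assoc (map just ps) (just p ∷ []) ms))

  prefixed-entry : ∀ l ps u v → sum (map (weight ps) (Npow l u v)) ≡ count l (continues l ps u v)
  prefixed-entry zero ps u v with does (u ≟ v)
  ... | false = refl
  ... | true  rewrite ++-identityʳ (numberWord ps) | ++-identityʳ (map just ps)
                    | normal-number-amplitude G ps | edgesOk-just ps = ℕ.+-identityʳ _
  prefixed-entry (suc l) ps u v =
    trans (sum-concatMap (weight ps) (λ w → Nmat u w · Npow l w v) (allFin n))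
          (cong sum (map-cong (λ w → first-step w (pairOf u w)) (allFin n)))
    where
    -- the first step u → w contributes the entry 𝐍_{u,w}, determined by
    -- m = pairOf u w: no monomial if u = w, and N_p if m = just p
    first-step : ∀ w (m : Maybe (Pair n)) →
      sum (map (weight ps) (maybe (λ p → (cre p ∷ ann p ∷ []) ∷ []) [] m · Npow l w v))
        ≡ count l (λ ws → does (last (w ∷ ws) ≟ v) ∧ edgesOk (map just ps ++ m ∷ steps (w ∷ toList ws)))
    first-step w nothing = sym (count-none l _ λ ws →
      trans (cong (does (last (w ∷ ws) ≟ v) ∧_) (edgesOk-nothing (map just ps) _)) (∧-zeroʳ _))
    first-step w (just p) = begin
      sum (map (weight ps) (((cre p ∷ ann p ∷ []) ∷ []) · Npow l w v))
        ≡⟨ absorb-factor ps p (Npow l w v) ⟩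
      sum (map (weight (ps ++ p ∷ [])) (Npow l w v))
        ≡⟨ prefixed-entry l (ps ++ p ∷ []) w v ⟩
      count l (continues l (ps ++ p ∷ []) w v)
        ≡⟨ count-cong l (λ ws → cong (does (last (w ∷ ws) ≟ v) ∧_) (edgesOk-snoc ps p _)) ⟩
      count l (λ ws → does (last (w ∷ ws) ≟ v) ∧ edgesOk (map just ps ++ just p ∷ steps (w ∷ toList ws))) ∎
      where open ≡-Reasoning

  trails-↔ : ∀ l u v → Σ (Vec (Fin n) l) (λ ws → continues l [] u v ws ≡ true) ↔ Trail G l u v
  trails-↔ l u v = mk↔ₛ′ to from to-from from-to
    where
    to : Σ (Vec (Fin n) l) (λ ws → continues l [] u v ws ≡ true) → Trail G l u v
    to (ws , ok) = u ∷ ws , refl , ends-at-v , is-trail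
      where
      ends-at-v : last (u ∷ ws) ≡ v
      ends-at-v = does-sound (last (u ∷ ws) ≟ v) (∧-conicalˡ (does (last (u ∷ ws) ≟ v)) _ ok)
      is-trail : isTrail G (u ∷ toList ws) ≡ true
      is-trail = ∧-conicalʳ (does (last (u ∷ ws) ≟ v)) _ ok
    from : Trail G l u v → Σ (Vec (Fin n) l) (λ ws → continues l [] u v ws ≡ true)
    from (.u ∷ ws , refl , ends , trail) = ws , cong₂ _∧_ (dec-true (last (u ∷ ws) ≟ v) ends) trail
    to-from : ∀ t → to (from t) ≡ t
    to-from (.u ∷ ws , refl , ends , trail) =
      cong₂ (λ e t → u ∷ ws , refl , e , t) (Fin-UIP _ _) (Bool-UIP _ _)
    from-to : ∀ s → from (to s) ≡ s
    from-to (ws , ok) = cong (ws ,_) (Bool-UIP _ _)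

-- The theorem

proposition1 : (n : ℕ) (G : Graph n) (l : ℕ) → 1 ≤ l → (u v : Fin n) →
    Fin (expect (psi G) (normal (Npow l u v))) ↔ Trail G l u v
proposition1 n G l _ u v =
  subst (λ m → Fin m ↔ Trail G l u v) (sym expectation-counts)
    (↔-trans (count-↔ l (continues G l [] u v)) (trails-↔ G l u v))
  where
  expectation-counts : expect (psi G) (normal (Npow l u v)) ≡ count l (continues G l [] u v)
  expectation-counts = trans (expect-normal G (Npow l u v)) (prefixed-entry G l [] u v)
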